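{- Let $\{\langle X_n,\tau^0_n,\tau^1_n\rangle\}_{n\in\mathbb{N}}$, $\{x_n\}$, $\{Y_n\}$, $\mathcal{U}$, $x_\ast$ and the ultrabouquet $\mathfrak{X}=\langle X,\tau^0,\tau^1\rangle$ be as in the context, let $v_n$ be a valuation on $\langle X_n,\tau^0_n,\tau^1_n\rangle$ for each $n$, and let $v$ be the valuation on $\mathfrak{X}$ determined by: for a propositional variable $p$ and $x\in X_n\setminus\{x_n\}$, $x\in v(p)$ iff $x\in v_n(p)$; and $x_\ast\in v(p)$ iff $\{n\in\mathbb{N}: x_n\in v_n(p)\}\in\mathcal{U}$. Then for every $\mathcal{L}(\Box,\rhd)$-formula $\varphi$, $x_\ast\in v(\varphi)$ if and only if $\{n\in\mathbb{N}: x_n\in v_n(\varphi)\}\in\mathcal{U}$.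
   Context: $\mathcal{L}(\Box,\rhd)$ has propositional variables, $\top,\bot$, $\neg,\land,\lor,\to$, unary $\Box,\Diamond$, binary $\rhd$. For a topology $\tau$ on $X$, $d_\tau(Y)=\{x: \text{every } U\in\tau \text{ containing } x \text{ meets } Y\setminus\{x\}\}$, $cd_\tau(Y)=X\setminus d_\tau(X\setminus Y)$; $\langle X,\tau\rangle$ is scattered if $Y\setminus d_\tau(Y)\ne\varnothing$ for all nonempty $Y$. A bitopological space is $\langle X,\tau^0,\tau^1\rangle$ with $X\neq\varnothing$, $\tau^0,\tau^1$ topologies; $e_{\tau^0,\tau^1}(Y,Z)=\{x:\forall U\in\tau^1[x\in d_{\tau^0}(Y\cap U)\Rightarrow x\in d_{\tau^0}(Z\cap U)]\}$; a valuation $v$ maps formulas to subsets of $X$, Boolean on connectives, with $v(\Box\varphi)=cd_{\tau^0}(v(\varphi))$, $v(\Diamond\varphi)=d_{\tau^0}(v(\varphi))$, $v(\varphi\rhd\psi)=e_{\tau^0,\tau^1}(v(\varphi),v(\psi))$; a valuation is determined by its values on propositional variables. Ultrabouquet setting: $\{\langle X_n,\tau^0_n,\tau^1_n\rangle\}_{n\in\mathbb{N}}$ are bitopological spaces with each $\langle X_n,\tau^0_n\rangle$ scattered and the $X_n$ pairwise disjoint; $x_n\in X_n$; $Y_n\subseteq X_n$ is a set with $x_n\in Y_n\in\tau^0_n$ and $Y_n\setminus\{x_n\}\in\tau^0_n$ (such sets exist); $\mathcal{U}$ is a non-principal ultrafilter on $\mathbb{N}$; $x_\ast\notin\bigcup_n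 X_n$ is a new point. Put $X=\bigcup_n(X_n\setminus\{x_n\})\cup\{x_\ast\}$. For $V\subseteq X$, $V\restriction X_n=V\cap X_n$ if $x_\ast\notin V$ and $V\restriction X_n=((V\setminus\{x_\ast\})\cup\{x_n\})\cap X_n$ if $x_\ast\in V$; $V\restriction Y_n$ is defined likewise with $Y_n$ in place of $X_n$. Then $U\in\tau^0$ iff (i) $U\cap(Y_n\setminus\{x_n\})\in\tau^0_n$ for every $n$, and (ii) if $x_\ast\in U$ then $\{n: U\restriction Y_n\in\tau^0_n\}\in\mathcal{U}$; and $U\in\tau^1$ iff $U\restriction X_n\in\tau^1_n$ for every $n$. $\mathfrak{X}=\langle X,\tau^0,\tau^1\rangle$ is a bitopological space, called the ultrabouquet. -}

module Defs where

open import Level using (Level; 0ℓ) renaming (suc to lsuc)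
open import Data.Nat using (ℕ)
open import Data.Empty using (⊥)
open import Data.Unit using (⊤)
open import Data.Product using (Σ; ∃; _×_; _,_)
open import Data.Sum using (_⊎_)
open import Relation.Nullary using (¬_)
open import Relation.Binary.PropositionalEquality using (_≡_; _≢_)
open import Function.Bundles using (_⇔_)

infixr 6 _∧'_
infixr 5 _∨'_
infixr 4 _⇒'_
infix  7 _▷_

data Fm : Set where
  var   : ℕ → Fm
  ⊤'    : Fm
  ⊥'    : Fm
  ¬'_   : Fm → Fm
  _∧'_  : Fm → Fm → Fm
  _∨'_  : Fm → Fm → Fm
  _⇒'_  : Fm → Fm → Fm
  □     : Fm → Fm
  ◇     : Fm → Fm
  _▷_   : Fm → Fm → Fm

-- Topologies.  Open sets are (Set-valued) predicates; a topology is
-- the predicate "is open".  Arbitrary subsets used in the semantics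
-- (truth sets) are Set₁-valued predicates.

record IsTopology {X : Set} (τ : (X → Set) → Set₁) : Set₁ where
  field
    ext   : (U V : X → Set) → (∀ x → U x ⇔ V x) → τ U → τ V
    empty : τ (λ _ → ⊥)
    full  : τ (λ _ → ⊤)
    inter : (U V : X → Set) → τ U → τ V → τ (λ x → U x × V x)
    union : (I : Set) (U : I → X → Set) → (∀ i → τ (U i)) →
            τ (λ x → Σ I (λ i → U i x))

module _ {X : Set} (τ : (X → Set) → Set₁) where

  der : (X → Set₁) → X → Set₁
  der A x = (U : X → Set) → τ U → U x → ∃ λ y → U y × A y × y ≢ x

  coder : (X → Set₁) → X → Set₁
  coder A x = ¬ der (λ y → ¬ A y) x

  Scattered : Set₂
  Scattered = (A : X → Set₁) → (∃ λ x → A x) → ∃ λ x → A x × ¬ der A x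

ederiv : {X : Set} (τ0 τ1 : (X → Set) → Set₁) → (X → Set₁) → (X → Set₁) → X → Set₁
ederiv {X} τ0 τ1 A B x = (U : X → Set) → τ1 U →
  der τ0 (λ y → A y × U y) x → der τ0 (λ y → B y × U y) x

⟦_⟧ : Fm → {X : Set} (τ0 τ1 : (X → Set) → Set₁) → (ℕ → X → Set₁) → X → Set₁
⟦ var p ⟧   τ0 τ1 V x = V p x
⟦ ⊤' ⟧      τ0 τ1 V x = Level.Lift _ ⊤
⟦ ⊥' ⟧      τ0 τ1 V x = Level.Lift _ ⊥
⟦ ¬' φ ⟧    τ0 τ1 V x = ¬ ⟦ φ ⟧ τ0 τ1 V x
⟦ φ ∧' ψ ⟧  τ0 τ1 V x = ⟦ φ ⟧ τ0 τ1 V x × ⟦ ψ ⟧ τ0 τ1 V x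
⟦ φ ∨' ψ ⟧  τ0 τ1 V x = ⟦ φ ⟧ τ0 τ1 V x ⊎ ⟦ ψ ⟧ τ0 τ1 V x
⟦ φ ⇒' ψ ⟧  τ0 τ1 V x = ⟦ φ ⟧ τ0 τ1 V x → ⟦ ψ ⟧ τ0 τ1 V x
⟦ □ φ ⟧     τ0 τ1 V x = coder τ0 (⟦ φ ⟧ τ0 τ1 V) x
⟦ ◇ φ ⟧     τ0 τ1 V x = der τ0 (⟦ φ ⟧ τ0 τ1 V) x
⟦ φ ▷ ψ ⟧   τ0 τ1 V x = ederiv τ0 τ1 (⟦ φ ⟧ τ0 τ1 V) (⟦ ψ ⟧ τ0 τ1 V) x

record IsUltrafilter (𝒰 : (ℕ → Set₁) → Set₁) : Set₂ where
  field
    full   : 𝒰 (λ _ → Level.Lift _ ⊤)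
    proper : ¬ 𝒰 (λ _ → Level.Lift _ ⊥)
    mono   : (A B : ℕ → Set₁) → (∀ n → A n → B n) → 𝒰 A → 𝒰 B
    inter  : (A B : ℕ → Set₁) → 𝒰 A → 𝒰 B → 𝒰 (λ n → A n × B n)
    ultra  : (A : ℕ → Set₁) → 𝒰 A ⊎ 𝒰 (λ n → ¬ A n)

NonPrincipal : ((ℕ → Set₁) → Set₁) → Set₁
NonPrincipal 𝒰 = (k : ℕ) → ¬ 𝒰 (λ n → Level.Lift _ (n ≡ k))

module Ultrabouquet
  (X : ℕ → Set) (xs : (n : ℕ) → X n) (Y : (n : ℕ) → X n → Set)
  (τ0 τ1 : (n : ℕ) → (X n → Set) → Set₁)
  (𝒰 : (ℕ → Set₁) → Set₁)
  (V : (n : ℕ) → ℕ → X n → Set₁) where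

  -- X = ⋃ₙ (Xₙ ∖ {xₙ}) ∪ {x∗}  (disjoint union)
  data Pt : Set where
    star : Pt
    pt   : (n : ℕ) (x : X n) → .(x ≢ xs n) → Pt

  capYminus : (Pt → Set) → (n : ℕ) → X n → Set
  capYminus U n x = Y n x × Σ (x ≢ xs n) (λ p → U (pt n x p))

  restrX : (Pt → Set) → (n : ℕ) → X n → Set
  restrX U n x = (x ≡ xs n × U star) ⊎ Σ (x ≢ xs n) (λ p → U (pt n x p))

  restrY : (Pt → Set) → (n : ℕ) → X n → Set
  restrY U n x = Y n x × restrX U n x

  τ0B : (Pt → Set) → Set₁
  τ0B U = ((n : ℕ) → τ0 n (capYminus U n))
        × (U star → 𝒰 (λ n → τ0 n (restrY U n)))

  τ1B : (Pt → Set) → Set₁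
  τ1B U = (n : ℕ) → τ1 n (restrX U n)

  VB : ℕ → Pt → Set₁
  VB p star       = 𝒰 (λ n → V n p (xs n))
  VB p (pt n x _) = V n p x

module Submission where

-- By induction on φ, proving at the same time that v and vₙ agree on Yₙ ∖ {xₙ}.
-- Near a point of Yₙ ∖ {xₙ} the ultrabouquet looks like Xₙ: τ⁰-open sets trace onto Yₙ
-- as τ⁰ₙ-open sets and back, and τ¹-open sets restrict to τ¹ₙ-open sets and back.  At x∗
-- the argument is a Łoś theorem: the ultrafilter commutes with the Boolean connectives;
-- x∗ ∈ d(A) iff xₙ ∈ dₙ(Aₙ) for 𝒰-many n, since the neighbourhoods of x∗ are the sets
-- whose traces are neighbourhoods of 𝒰-many xₙ; and for ▷, a τ¹-open set restricts to
-- τ¹ₙ-open sets, while τ¹ₙ-open sets whose values at the xₙ agree glue to a τ¹-open set.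

open import Defs
open import Level using (Level; Lift; lift)
open import Data.Nat using (ℕ; _≟_)
open import Data.Product using (_×_; Σ; ∃; _,_; proj₁; proj₂; uncurry)
open import Data.Product.Function.NonDependent.Propositional using (_×-⇔_)
open import Data.Sum using (_⊎_; inj₁; inj₂; [_,_])
open import Data.Sum.Function.Propositional using (_⊎-⇔_)
open import Data.Empty using (⊥; ⊥-elim)
open import Data.Unit using (⊤; tt)
open import Function using (id)
open import Function.Bundles using (_⇔_; mk⇔; Equivalence)
open import Function.Construct.Identity using (⇔-id)
open import Function.Construct.Symmetry using (⇔-sym)
open import Function.Construct.Composition using (_⇔-∘_)
open import Function.Related.TypeIsomorphisms using (¬-cong-⇔; →-cong-⇔)
open import Relation.Nullary using (¬_; Dec; yes; no)
open import Relation.Nullary.Decidable using (decidable-stable)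
open import Relation.Nullary.Recomputable using (¬-recompute)
open import Relation.Binary.PropositionalEquality using (_≡_; refl; _≢_)
open import Axiom.ExcludedMiddle using (ExcludedMiddle)

open Equivalence using (to; from)

der-mono : {X : Set} (τ : (X → Set) → Set₁) {A B : X → Set₁} →
  (∀ y → A y → B y) → ∀ {x} → der τ A x → der τ B x
der-mono τ A⊆B d U τU Ux with d U τU Ux
... | y , Uy , Ay , y≢x = y , Uy , A⊆B y Ay , y≢x

module UltrafilterProperties {𝒰 : (ℕ → Set₁) → Set₁} (uf : IsUltrafilter 𝒰) where

  open IsUltrafilter uf

  mono₂ : {A B C : ℕ → Set₁} → (∀ n → A n → B n → C n) → 𝒰 A → 𝒰 B → 𝒰 C
  mono₂ f 𝒰A 𝒰B = mono _ _ (λ n (a , b) → f n a b) (inter _ _ 𝒰A 𝒰B)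

  empty∉ : {A : ℕ → Set₁} → (∀ n → ¬ A n) → ¬ 𝒰 A
  empty∉ ¬A 𝒰A = proper (mono _ _ (λ n a → ⊥-elim (¬A n a)) 𝒰A)

  𝒰-⊤ : {ℓ : Level} → Lift ℓ ⊤ ⇔ 𝒰 (λ _ → Lift _ ⊤)
  𝒰-⊤ = mk⇔ (λ _ → full) (λ _ → lift tt)

  𝒰-⊥ : {ℓ : Level} → Lift ℓ ⊥ ⇔ 𝒰 (λ _ → Lift _ ⊥)
  𝒰-⊥ = mk⇔ (λ ()) (λ 𝒰∅ → ⊥-elim (proper 𝒰∅))

  𝒰-¬ : {A : ℕ → Set₁} → (¬ 𝒰 A) ⇔ 𝒰 (λ n → ¬ A n)
  𝒰-¬ {A} = mk⇔ (λ ¬𝒰A → [ (λ 𝒰A → ⊥-elim (¬𝒰A 𝒰A)) , id ] (ultra A))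
                (λ 𝒰¬A 𝒰A → empty∉ (λ n (a , ¬a) → ¬a a) (inter _ _ 𝒰A 𝒰¬A))

  𝒰-× : {A B : ℕ → Set₁} → (𝒰 A × 𝒰 B) ⇔ 𝒰 (λ n → A n × B n)
  𝒰-× = mk⇔ (uncurry (inter _ _)) (λ 𝒰A×B → mono _ _ (λ _ → proj₁) 𝒰A×B , mono _ _ (λ _ → proj₂) 𝒰A×B)

  𝒰-⊎ : {A B : ℕ → Set₁} → (𝒰 A ⊎ 𝒰 B) ⇔ 𝒰 (λ n → A n ⊎ B n)
  𝒰-⊎ {A} {B} = mk⇔ [ mono _ _ (λ _ → inj₁) , mono _ _ (λ _ → inj₂) ] split
    where
    split : 𝒰 (λ n → A n ⊎ B n) → 𝒰 A ⊎ 𝒰 B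
    split 𝒰A⊎B with ultra A
    ... | inj₁ 𝒰A  = inj₁ 𝒰A
    ... | inj₂ 𝒰¬A = inj₂ (mono₂ (λ _ a⊎b ¬a → [ (λ a → ⊥-elim (¬a a)) , id ] a⊎b) 𝒰A⊎B 𝒰¬A)

  𝒰-→ : {A B : ℕ → Set₁} → (𝒰 A → 𝒰 B) ⇔ 𝒰 (λ n → A n → B n)
  𝒰-→ {A} {B} = mk⇔ pointwise (mono₂ (λ _ f a → f a))
    where
    pointwise : (𝒰 A → 𝒰 B) → 𝒰 (λ n → A n → B n)
    pointwise f with ultra A
    ... | inj₁ 𝒰A  = mono _ _ (λ _ b _ → b) (f 𝒰A)
    ... | inj₂ 𝒰¬A = mono _ _ (λ _ ¬a a → ⊥-elim (¬a a)) 𝒰¬A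

  𝒰-constant : (P : ℕ → Set) → ∃ λ (s : Set) → 𝒰 (λ n → Lift _ (P n ⇔ s))
  𝒰-constant P with ultra (λ n → Lift _ (P n))
  ... | inj₁ 𝒰P  = ⊤ , mono _ _ (λ _ (lift p) → lift (mk⇔ (λ _ → tt) (λ _ → p))) 𝒰P
  ... | inj₂ 𝒰¬P = ⊥ , mono _ _ (λ _ ¬p → lift (mk⇔ (λ p → ¬p (lift p)) ⊥-elim)) 𝒰¬P

module Classical (lem : {ℓ : Level} → ExcludedMiddle ℓ) where

  dne : {ℓ : Level} {P : Set ℓ} → ¬ ¬ P → P
  dne = decidable-stable lem

  𝒰-nonempty : {𝒰 : (ℕ → Set₁) → Set₁} → IsUltrafilter 𝒰 → {A : ℕ → Set₁} → 𝒰 A → ∃ A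
  𝒰-nonempty uf 𝒰A = dne (λ ∄A → UltrafilterProperties.empty∉ uf (λ n a → ∄A (n , a)) 𝒰A)

  module _ {X : Set} where

    -- W when W x ⇔ s, the constant s otherwise
    pinned : (X → Set) → X → Set → X → Set
    pinned W x s z = (W x ⇔ s → W z) × (¬ (W x ⇔ s) → s)

    pinned-agrees : {W : X → Set} {x : X} {s : Set} → W x ⇔ s → ∀ z → pinned W x s z ⇔ W z
    pinned-agrees Wx⇔s z = mk⇔ (λ (w , _) → w Wx⇔s) (λ w → (λ _ → w) , (λ ¬Wx⇔s → ⊥-elim (¬Wx⇔s Wx⇔s)))

    pinned-point : (W : X → Set) (x : X) (s : Set) → pinned W x s x ⇔ s
    pinned-point W x s with lem {P = W x ⇔ s}
    ... | yes Wx⇔s = mk⇔ (λ (w , _) → to Wx⇔s (w Wx⇔s)) (λ s′ → (λ Wx⇔s → from Wx⇔s s′) , (λ _ → s′))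
    ... | no ¬Wx⇔s = mk⇔ (λ (_ , c) → c ¬Wx⇔s) (λ s′ → (λ Wx⇔s → from Wx⇔s s′) , (λ _ → s′))

  module _ {X : Set} {τ : (X → Set) → Set₁} where

    ¬der⇒isolated : {A : X → Set₁} {x : X} → ¬ der τ A x →
      ∃ λ W → τ W × W x × (∀ z → W z → A z → z ≡ x)
    ¬der⇒isolated ¬d = dne λ ∄W → ¬d λ W τW Wx →
      dne λ ¬meets → ∄W (W , τW , Wx , λ z Wz Az → dne λ z≢x → ¬meets (z , Wz , Az , z≢x))

    module _ (top : IsTopology τ) where

      open IsTopology top

      const-open : (S : Set) → τ (λ _ → S)
      const-open S with lem {P = S}
      ... | yes s = ext _ _ (λ _ → mk⇔ (λ _ → s) (λ _ → tt)) full
      ... | no ¬s = ext _ _ (λ _ → mk⇔ ⊥-elim ¬s) empty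

      pinned-open : {W : X → Set} → τ W → (x : X) (s : Set) → τ (pinned W x s)
      pinned-open {W} τW x s with lem {P = W x ⇔ s}
      ... | yes Wx⇔s = ext _ _ (λ z → ⇔-sym (pinned-agrees {W = W} {x = x} {s = s} Wx⇔s z)) τW
      ... | no ¬Wx⇔s = ext _ _
              (λ _ → mk⇔ (λ s′ → (λ Wx⇔s → ⊥-elim (¬Wx⇔s Wx⇔s)) , (λ _ → s′)) (λ (_ , c) → c ¬Wx⇔s))
              (const-open s)

      isolating-open : (A : X → Set₁) (x : X) →
        Σ (X → Set) λ W → τ W × (∀ z → W z → A z → z ≡ x) × (¬ der τ A x → W x)
      isolating-open A x with lem {P = der τ A x}
      ... | yes d  = (λ _ → ⊥) , empty , (λ _ ()) , (λ ¬d → ⊥-elim (¬d d))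
      ... | no ¬d with ¬der⇒isolated ¬d
      ...   | W , τW , Wx , iso = W , τW , iso , (λ _ → Wx)

  module _ {X : Set} {τ0 τ1 : (X → Set) → Set₁} where

    ¬ederiv⇒separated : {A B : X → Set₁} {x : X} → ¬ ederiv τ0 τ1 A B x →
      ∃ λ W → τ1 W × der τ0 (λ y → A y × W y) x × ¬ der τ0 (λ y → B y × W y) x
    ¬ederiv⇒separated ¬e = dne λ ∄W → ¬e λ W τW dA → dne λ ¬dB → ∄W (W , τW , dA , ¬dB)

    separating-open : IsTopology τ1 → (A B : X → Set₁) (x : X) →
      Σ (X → Set) λ W → τ1 W ×
        (¬ ederiv τ0 τ1 A B x → der τ0 (λ y → A y × W y) x × ¬ der τ0 (λ y → B y × W y) x)
    separating-open top1 A B x with lem {P = ederiv τ0 τ1 A B x}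
    ... | yes e  = (λ _ → ⊥) , IsTopology.empty top1 , (λ ¬e → ⊥-elim (¬e e))
    ... | no ¬e with ¬ederiv⇒separated ¬e
    ...   | W , τW , dA , ¬dB = W , τW , (λ _ → dA , ¬dB)

module _ {X : ℕ → Set} where

  onlyAt : {m n : ℕ} → Dec (m ≡ n) → (X n → Set) → Set → X m → Set
  onlyAt (yes refl) W S = W
  onlyAt (no _)     W S = λ _ → S

  onlyAt-here : {n : ℕ} (d : Dec (n ≡ n)) {W : X n → Set} {S : Set} (z : X n) →
    onlyAt d W S z ⇔ W z
  onlyAt-here (yes refl) z = ⇔-id _
  onlyAt-here (no n≢n)   z = ⊥-elim (n≢n refl)

  onlyAt-point : (x : (m : ℕ) → X m) {m n : ℕ} (d : Dec (m ≡ n)) (W : X n → Set) →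
    onlyAt d W (W (x n)) (x m) ⇔ W (x n)
  onlyAt-point x (yes refl) W = ⇔-id _
  onlyAt-point x (no _)     W = ⇔-id _

  onlyAt-open : (τ : (m : ℕ) → (X m → Set) → Set₁) {m n : ℕ} (d : Dec (m ≡ n))
    {W : X n → Set} {S : Set} → τ n W → τ m (λ _ → S) → τ m (onlyAt d W S)
  onlyAt-open τ (yes refl) τW τS = τW
  onlyAt-open τ (no _)     τW τS = τS

module UltrabouquetValuation (lem : {ℓ : Level} → ExcludedMiddle ℓ)
    (X : ℕ → Set) (τ0 τ1 : (n : ℕ) → (X n → Set) → Set₁)
    (top0 : (n : ℕ) → IsTopology (τ0 n)) (top1 : (n : ℕ) → IsTopology (τ1 n))
    (xs : (n : ℕ) → X n) (Y : (n : ℕ) → X n → Set)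
    (xs∈Y : (n : ℕ) → Y n (xs n)) (Yopen : (n : ℕ) → τ0 n (Y n))
    (Y-open : (n : ℕ) → τ0 n (λ x → Y n x × x ≢ xs n))
    (𝒰 : (ℕ → Set₁) → Set₁) (ultra : IsUltrafilter 𝒰)
    (V : (n : ℕ) → ℕ → X n → Set₁) where

  open Ultrabouquet X xs Y τ0 τ1 𝒰 V
  open Classical lem
  open UltrafilterProperties ultra
  module UF = IsUltrafilter ultra
  module T0 (n : ℕ) = IsTopology (top0 n)
  module T1 (n : ℕ) = IsTopology (top1 n)

  pt-injective : {n : ℕ} {y z : X n} .{p : y ≢ xs n} .{q : z ≢ xs n} → pt n y p ≡ pt n z q → y ≡ z
  pt-injective refl = refl

  glue : ((m : ℕ) → X m → Set) → Set → Pt → Set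
  glue W s star       = s
  glue W s (pt m z _) = W m z

  restrX-glue : {W : (m : ℕ) → X m → Set} {s : Set} {m : ℕ} → W m (xs m) ⇔ s →
    ∀ z → restrX (glue W s) m z ⇔ W m z
  restrX-glue {W} {s} {m} Wxs⇔s z = mk⇔ restricted unrestricted
    where
    restricted : restrX (glue W s) m z → W m z
    restricted (inj₁ (refl , s′)) = from Wxs⇔s s′
    restricted (inj₂ (_ , w))     = w
    unrestricted : W m z → restrX (glue W s) m z
    unrestricted w with lem {P = z ≡ xs m}
    ... | yes refl = inj₁ (refl , to Wxs⇔s w)
    ... | no z≢xs  = inj₂ (z≢xs , w)

  glue-τ1 : {W : (m : ℕ) → X m → Set} {s : Set} →
    (∀ m → W m (xs m) ⇔ s) → (∀ m → τ1 m (W m)) → τ1B (glue W s)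
  glue-τ1 {W} Wxs⇔s τW m = T1.ext m _ _ (λ z → ⇔-sym (restrX-glue {W} (Wxs⇔s m) z)) (τW m)

  capYminus-glue-open : {W : (m : ℕ) → X m → Set} {s : Set} (m : ℕ) →
    τ0 m (W m) → τ0 m (capYminus (glue W s) m)
  capYminus-glue-open m τW = T0.ext m _ _
    (λ x → mk⇔ (λ ((Yx , x≢xs) , Wx) → Yx , x≢xs , Wx) (λ (Yx , x≢xs , Wx) → (Yx , x≢xs) , Wx))
    (T0.inter m _ _ (Y-open m) τW)

  glue-τ0 : {W : (m : ℕ) → X m → Set} → (∀ m → τ0 m (W m)) → τ0B (glue W ⊥)
  glue-τ0 {W} τW = (λ m → capYminus-glue-open {W} {⊥} m (τW m)) , λ ()

  record AgreeOnY {a b : Level} (n : ℕ) (A : Pt → Set a) (An : X n → Set b) : Set (a Level.⊔ b) where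
    field
      at : ∀ y (y≢xs : y ≢ xs n) → Y n y → A (pt n y y≢xs) ⇔ An y

  open AgreeOnY

  module _ {n : ℕ} {a b : Level} {A : Pt → Set a} {An : X n → Set b} where

    agree-¬ : AgreeOnY n A An → AgreeOnY n (λ q → ¬ A q) (λ y → ¬ An y)
    agree-¬ A≈An .at y y≢xs Yy = ¬-cong-⇔ (A≈An .at y y≢xs Yy)

    agree-∩ : {U : Pt → Set} {W : X n → Set} → AgreeOnY n A An → AgreeOnY n U W →
      AgreeOnY n (λ q → A q × U q) (λ y → An y × W y)
    agree-∩ A≈An U≈W .at y y≢xs Yy = A≈An .at y y≢xs Yy ×-⇔ U≈W .at y y≢xs Yy

  agree-restrX : (U : Pt → Set) (n : ℕ) → AgreeOnY n U (restrX U n)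
  agree-restrX U n .at y y≢xs _ = mk⇔ (λ u → inj₂ (y≢xs , u)) unrestricted
    where
    unrestricted : restrX U n y → U (pt n y y≢xs)
    unrestricted (inj₁ (y≡xs , _)) = ⊥-elim (y≢xs y≡xs)
    unrestricted (inj₂ (_ , u))    = u

  embedY : (n : ℕ) → (X n → Set) → Pt → Set
  embedY n W = glue (λ m → onlyAt (m ≟ n) (λ z → Y n z × W z) ⊥) ⊥

  embedY-open : {n : ℕ} {W : X n → Set} → τ0 n W → τ0B (embedY n W)
  embedY-open {n} τW = glue-τ0 (λ m → onlyAt-open τ0 (m ≟ n) (T0.inter n _ _ (Yopen n) τW) (T0.empty m))

  extend : (n : ℕ) → (X n → Set) → Pt → Set
  extend n W = glue (λ m → onlyAt (m ≟ n) W (W (xs n))) (W (xs n))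

  extend-open : {n : ℕ} {W : X n → Set} → τ1 n W → τ1B (extend n W)
  extend-open {n} {W} τW = glue-τ1 (λ m → onlyAt-point xs (m ≟ n) W)
                                   (λ m → onlyAt-open τ1 (m ≟ n) τW (const-open (top1 m) (W (xs n))))

  extend-agrees : {n : ℕ} (W : X n → Set) → AgreeOnY n (extend n W) W
  extend-agrees {n} W .at y _ _ = onlyAt-here (n ≟ n) y

  der-local : {n : ℕ} {A : Pt → Set₁} {An : X n → Set₁} →
    AgreeOnY n A An → AgreeOnY n (der τ0B A) (der (τ0 n) An)
  der-local {n} {A} {An} A≈An .at y y≢xs Yy = mk⇔ local→ local←
    where
    fromEmbedY : {W : X n → Set} (q : Pt) → embedY n W q → A q → q ≢ pt n y y≢xs →
      ∃ λ z → W z × An z × z ≢ y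
    fromEmbedY (pt m z z≢xs) Uz Az ne with m ≟ n
    fromEmbedY (pt m z z≢xs) (Yz , Wz) Az ne | yes refl =
      z , Wz , to (A≈An .at z (¬-recompute z≢xs) Yz) Az , λ { refl → ne refl }
    local→ : der τ0B A (pt n y y≢xs) → der (τ0 n) An y
    local→ d W τW Wy with d (embedY n W) (embedY-open τW) (from (onlyAt-here (n ≟ n) y) (Yy , Wy))
    ... | q , Uq , Aq , q≢y = fromEmbedY q Uq Aq q≢y
    local← : der (τ0 n) An y → der τ0B A (pt n y y≢xs)
    local← d U τU Uy with d (capYminus U n) (proj₁ τU n) (Yy , y≢xs , Uy)
    ... | z , (Yz , z≢xs , Uz) , Anz , z≢y =
      pt n z z≢xs , Uz , from (A≈An .at z z≢xs Yz) Anz , λ e → z≢y (pt-injective e)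

  ederiv-local : {n : ℕ} {A B : Pt → Set₁} {An Bn : X n → Set₁} →
    AgreeOnY n A An → AgreeOnY n B Bn → AgreeOnY n (ederiv τ0B τ1B A B) (ederiv (τ0 n) (τ1 n) An Bn)
  ederiv-local {n} {A} {B} {An} {Bn} A≈An B≈Bn .at y y≢xs Yy = mk⇔ local→ local←
    where
    der∩ : {C : Pt → Set₁} {Cn : X n → Set₁} {U : Pt → Set} {W : X n → Set} →
      AgreeOnY n C Cn → AgreeOnY n U W →
      der τ0B (λ q → C q × U q) (pt n y y≢xs) ⇔ der (τ0 n) (λ z → Cn z × W z) y
    der∩ C≈Cn U≈W = der-local (agree-∩ C≈Cn U≈W) .at y y≢xs Yy
    local→ : ederiv τ0B τ1B A B (pt n y y≢xs) → ederiv (τ0 n) (τ1 n) An Bn y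
    local→ e W τW dA = to (der∩ B≈Bn (extend-agrees W))
      (e (extend n W) (extend-open τW) (from (der∩ A≈An (extend-agrees W)) dA))
    local← : ederiv (τ0 n) (τ1 n) An Bn y → ederiv τ0B τ1B A B (pt n y y≢xs)
    local← e U τU dA = from (der∩ B≈Bn (agree-restrX U n))
      (e (restrX U n) (τU n) (to (der∩ A≈An (agree-restrX U n)) dA))

  𝒰-der⇒der-star : {A : Pt → Set₁} {An : (n : ℕ) → X n → Set₁} → (∀ n → AgreeOnY n A (An n)) →
    𝒰 (λ n → der (τ0 n) (An n) (xs n)) → der τ0B A star
  𝒰-der⇒der-star A≈An 𝒰d U (_ , τU↾Y) U∗ with 𝒰-nonempty ultra (UF.inter _ _ 𝒰d (τU↾Y U∗))
  ... | n , d , τUn with d (restrY U n) τUn (xs∈Y n , inj₁ (refl , U∗))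
  ...   | z , (_ , inj₁ (z≡xs , _)) , _ , z≢xs = ⊥-elim (z≢xs z≡xs)
  ...   | z , (Yz , inj₂ (z≢xs , Uz)) , Az , _ = pt n z z≢xs , Uz , from (A≈An n .at z z≢xs Yz) Az , λ ()

  -- If 𝒰-many xₙ are isolated from Aₙ by neighbourhoods Wₙ, then x∗ together with
  -- all the Yₙ ∩ Wₙ is a τ⁰-neighbourhood isolating x∗ from A.
  𝒰-¬der⇒¬der-star : {A : Pt → Set₁} {An : (n : ℕ) → X n → Set₁} → (∀ n → AgreeOnY n A (An n)) →
    𝒰 (λ n → ¬ der (τ0 n) (An n) (xs n)) → ¬ der τ0B A star
  𝒰-¬der⇒¬der-star {A} {An} A≈An 𝒰¬d d =
    let q , Uq , Aq , q≢star = d U τ0U tt in q≢star (U∩A⊆star q Uq Aq)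
    where
    isolating : ∀ n → Σ (X n → Set) λ W → τ0 n W ×
      (∀ z → W z → An n z → z ≡ xs n) × (¬ der (τ0 n) (An n) (xs n) → W (xs n))
    isolating n = isolating-open (top0 n) (An n) (xs n)
    W : (n : ℕ) → X n → Set
    W n = proj₁ (isolating n)
    τW : ∀ n → τ0 n (W n)
    τW n = proj₁ (proj₂ (isolating n))
    W-isolates : ∀ n z → W n z → An n z → z ≡ xs n
    W-isolates n = proj₁ (proj₂ (proj₂ (isolating n)))
    W-covers : ∀ n → ¬ der (τ0 n) (An n) (xs n) → W n (xs n)
    W-covers n = proj₂ (proj₂ (proj₂ (isolating n)))
    YW : (n : ℕ) → X n → Set
    YW n z = Y n z × W n z
    U : Pt → Set
    U = glue YW ⊤
    τ0U↾Y : ∀ n → ¬ der (τ0 n) (An n) (xs n) → τ0 n (restrY U n)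
    τ0U↾Y n ¬d = T0.ext n _ _ (λ x → ⇔-sym (⇔-id (Y n x) ×-⇔ restrX-glue {YW} YWxs⇔⊤ x))
        (T0.inter n _ _ (Yopen n) (T0.inter n _ _ (Yopen n) (τW n)))
      where
      YWxs⇔⊤ : YW n (xs n) ⇔ ⊤
      YWxs⇔⊤ = mk⇔ (λ _ → tt) (λ _ → xs∈Y n , W-covers n ¬d)
    τ0U : τ0B U
    τ0U = (λ m → capYminus-glue-open {YW} {⊤} m (T0.inter m _ _ (Yopen m) (τW m)))
        , (λ _ → UF.mono _ _ τ0U↾Y 𝒰¬d)
    U∩A⊆star : (q : Pt) → U q → A q → q ≡ star
    U∩A⊆star star _ _ = refl
    U∩A⊆star (pt n z z≢xs) (Yz , Wz) Az =
      ⊥-elim (¬-recompute z≢xs (W-isolates n z Wz (to (A≈An n .at z (¬-recompute z≢xs) Yz) Az)))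

  der-global : {A : Pt → Set₁} {An : (n : ℕ) → X n → Set₁} → (∀ n → AgreeOnY n A (An n)) →
    der τ0B A star ⇔ 𝒰 (λ n → der (τ0 n) (An n) (xs n))
  der-global A≈An = mk⇔ (λ d → dne λ ¬𝒰d → 𝒰-¬der⇒¬der-star A≈An (to 𝒰-¬ ¬𝒰d) d)
                        (𝒰-der⇒der-star A≈An)

  der∩-global : {A : Pt → Set₁} {An : (n : ℕ) → X n → Set₁} → (∀ n → AgreeOnY n A (An n)) →
    (U : Pt → Set) →
    der τ0B (λ q → A q × U q) star ⇔ 𝒰 (λ n → der (τ0 n) (λ z → An n z × restrX U n z) (xs n))
  der∩-global A≈An U = der-global (λ n → agree-∩ (A≈An n) (agree-restrX U n))

  𝒰-ederiv⇒ederiv-star : {A B : Pt → Set₁} {An Bn : (n : ℕ) → X n → Set₁} →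
    (∀ n → AgreeOnY n A (An n)) → (∀ n → AgreeOnY n B (Bn n)) →
    𝒰 (λ n → ederiv (τ0 n) (τ1 n) (An n) (Bn n) (xs n)) → ederiv τ0B τ1B A B star
  𝒰-ederiv⇒ederiv-star A≈An B≈Bn 𝒰e U τU dA = from (der∩-global B≈Bn U)
    (mono₂ (λ n e dAn → e (restrX U n) (τU n) dAn) 𝒰e (to (der∩-global A≈An U) dA))

  -- The separating sets Wₙ can only be glued if their values at the xₙ agree: 𝒰-constant
  -- finds a value s taken by 𝒰-many of them, and the others are pinned to s.
  𝒰-¬ederiv⇒¬ederiv-star : {A B : Pt → Set₁} {An Bn : (n : ℕ) → X n → Set₁} →
    (∀ n → AgreeOnY n A (An n)) → (∀ n → AgreeOnY n B (Bn n)) →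
    𝒰 (λ n → ¬ ederiv (τ0 n) (τ1 n) (An n) (Bn n) (xs n)) → ¬ ederiv τ0B τ1B A B star
  𝒰-¬ederiv⇒¬ederiv-star {A} {B} {An} {Bn} A≈An B≈Bn 𝒰¬e e = empty∉ refuted (UF.inter _ _ 𝒰good 𝒰dB)
    where
    separating : ∀ n → Σ (X n → Set) λ W → τ1 n W ×
      (¬ ederiv (τ0 n) (τ1 n) (An n) (Bn n) (xs n) →
        der (τ0 n) (λ z → An n z × W z) (xs n) × ¬ der (τ0 n) (λ z → Bn n z × W z) (xs n))
    separating n = separating-open {τ0 = τ0 n} (top1 n) (An n) (Bn n) (xs n)
    W : (n : ℕ) → X n → Set
    W n = proj₁ (separating n)
    τW : ∀ n → τ1 n (W n)
    τW n = proj₁ (proj₂ (separating n))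
    W-separates : ∀ n → ¬ ederiv (τ0 n) (τ1 n) (An n) (Bn n) (xs n) →
      der (τ0 n) (λ z → An n z × W n z) (xs n) × ¬ der (τ0 n) (λ z → Bn n z × W n z) (xs n)
    W-separates n = proj₂ (proj₂ (separating n))
    s : Set
    s = proj₁ (𝒰-constant (λ n → W n (xs n)))
    Good : ℕ → Set₁
    Good n = ¬ ederiv (τ0 n) (τ1 n) (An n) (Bn n) (xs n) × Lift _ (W n (xs n) ⇔ s)
    𝒰good : 𝒰 Good
    𝒰good = UF.inter _ _ 𝒰¬e (proj₂ (𝒰-constant (λ n → W n (xs n))))
    W′ : (n : ℕ) → X n → Set
    W′ n = pinned (W n) (xs n) s
    U : Pt → Set
    U = glue W′ s
    τ1U : τ1B U
    τ1U = glue-τ1 {W′} (λ n → pinned-point (W n) (xs n) s) (λ n → pinned-open (top1 n) (τW n) (xs n) s)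
    U↾X≈W : ∀ n → W n (xs n) ⇔ s → ∀ z → restrX U n z ⇔ W n z
    U↾X≈W n Wxs⇔s z = pinned-agrees {W = W n} Wxs⇔s z ⇔-∘ restrX-glue {W′} (pinned-point (W n) (xs n) s) z
    𝒰dA : 𝒰 (λ n → der (τ0 n) (λ z → An n z × restrX U n z) (xs n))
    𝒰dA = UF.mono _ _ (λ n (¬en , lift Wxs⇔s) → der-mono (τ0 n)
            (λ z (a , w) → a , from (U↾X≈W n Wxs⇔s z) w) (proj₁ (W-separates n ¬en))) 𝒰good
    𝒰dB : 𝒰 (λ n → der (τ0 n) (λ z → Bn n z × restrX U n z) (xs n))
    𝒰dB = to (der∩-global B≈Bn U) (e U τ1U (from (der∩-global A≈An U) 𝒰dA))
    refuted : ∀ n → ¬ (Good n × der (τ0 n) (λ z → Bn n z × restrX U n z) (xs n))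
    refuted n ((¬en , lift Wxs⇔s) , dB) = proj₂ (W-separates n ¬en)
      (der-mono (τ0 n) (λ z (b , u) → b , to (U↾X≈W n Wxs⇔s z) u) dB)

  ederiv-global : {A B : Pt → Set₁} {An Bn : (n : ℕ) → X n → Set₁} →
    (∀ n → AgreeOnY n A (An n)) → (∀ n → AgreeOnY n B (Bn n)) →
    ederiv τ0B τ1B A B star ⇔ 𝒰 (λ n → ederiv (τ0 n) (τ1 n) (An n) (Bn n) (xs n))
  ederiv-global A≈An B≈Bn =
    mk⇔ (λ e → dne λ ¬𝒰e → 𝒰-¬ederiv⇒¬ederiv-star A≈An B≈Bn (to 𝒰-¬ ¬𝒰e) e)
        (𝒰-ederiv⇒ederiv-star A≈An B≈Bn)

  ⟦_⟧B : Fm → Pt → Set₁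
  ⟦ φ ⟧B = ⟦ φ ⟧ τ0B τ1B VB

  ⟦_⟧at : Fm → (n : ℕ) → X n → Set₁
  ⟦ φ ⟧at n = ⟦ φ ⟧ (τ0 n) (τ1 n) (V n)

  truth-local : (φ : Fm) (n : ℕ) → AgreeOnY n ⟦ φ ⟧B (⟦ φ ⟧at n)
  truth-local (var p)  n .at y _ _ = ⇔-id _
  truth-local ⊤'       n .at y _ _ = ⇔-id _
  truth-local ⊥'       n .at y _ _ = ⇔-id _
  truth-local (¬' φ)   n .at y p Yy = ¬-cong-⇔ (truth-local φ n .at y p Yy)
  truth-local (φ ∧' ψ) n .at y p Yy = truth-local φ n .at y p Yy ×-⇔ truth-local ψ n .at y p Yy
  truth-local (φ ∨' ψ) n .at y p Yy = truth-local φ n .at y p Yy ⊎-⇔ truth-local ψ n .at y p Yy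
  truth-local (φ ⇒' ψ) n .at y p Yy = →-cong-⇔ (truth-local φ n .at y p Yy) (truth-local ψ n .at y p Yy)
  truth-local (□ φ)    n .at y p Yy = ¬-cong-⇔ (der-local (agree-¬ (truth-local φ n)) .at y p Yy)
  truth-local (◇ φ)    n = der-local (truth-local φ n)
  truth-local (φ ▷ ψ)  n = ederiv-local (truth-local φ n) (truth-local ψ n)

  truth-global : (φ : Fm) → ⟦ φ ⟧B star ⇔ 𝒰 (λ n → ⟦ φ ⟧at n (xs n))
  truth-global (var p)  = ⇔-id _
  truth-global ⊤'       = 𝒰-⊤
  truth-global ⊥'       = 𝒰-⊥
  truth-global (¬' φ)   = 𝒰-¬ ⇔-∘ ¬-cong-⇔ (truth-global φ)
  truth-global (φ ∧' ψ) = 𝒰-× ⇔-∘ (truth-global φ ×-⇔ truth-global ψ)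
  truth-global (φ ∨' ψ) = 𝒰-⊎ ⇔-∘ (truth-global φ ⊎-⇔ truth-global ψ)
  truth-global (φ ⇒' ψ) = 𝒰-→ ⇔-∘ →-cong-⇔ (truth-global φ) (truth-global ψ)
  truth-global (□ φ)    = 𝒰-¬ ⇔-∘ ¬-cong-⇔ (der-global (λ n → agree-¬ (truth-local φ n)))
  truth-global (◇ φ)    = der-global (truth-local φ)
  truth-global (φ ▷ ψ)  = ederiv-global (truth-local φ) (truth-local ψ)

lemma4p8 : (lem : {ℓ : Level} → ExcludedMiddle ℓ)
    (X : ℕ → Set) (τ0 τ1 : (n : ℕ) → (X n → Set) → Set₁)
    (top0 : (n : ℕ) → IsTopology (τ0 n)) (top1 : (n : ℕ) → IsTopology (τ1 n))
    (scat : (n : ℕ) → Scattered (τ0 n))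
    (xs : (n : ℕ) → X n) (Y : (n : ℕ) → X n → Set)
    (xs∈Y : (n : ℕ) → Y n (xs n)) (Yopen : (n : ℕ) → τ0 n (Y n))
    (Y-open : (n : ℕ) → τ0 n (λ x → Y n x × x ≢ xs n))
    (𝒰 : (ℕ → Set₁) → Set₁) (ultra : IsUltrafilter 𝒰) (nonpr : NonPrincipal 𝒰)
    (V : (n : ℕ) → ℕ → X n → Set₁) (φ : Fm) →
    ⟦ φ ⟧ (Ultrabouquet.τ0B X xs Y τ0 τ1 𝒰 V) (Ultrabouquet.τ1B X xs Y τ0 τ1 𝒰 V)
          (Ultrabouquet.VB X xs Y τ0 τ1 𝒰 V) (Ultrabouquet.star)
      ⇔ 𝒰 (λ n → ⟦ φ ⟧ (τ0 n) (τ1 n) (V n) (xs n))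
lemma4p8 lem X τ0 τ1 top0 top1 _ xs Y xs∈Y Yopen Y-open 𝒰 ultra _ V =
  UltrabouquetValuation.truth-global lem X τ0 τ1 top0 top1 xs Y xs∈Y Yopen Y-open 𝒰 ultra V
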